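{- For all positive integers $N$ and $k$, $$(q)_N^2\sum_{r=1}^{N}\frac{(-1)^{r-1}q^{\frac{r(r-1)}{2}+kr}(1+q^r)}{(q)_{N-r}(q)_{N+r}(1-q^r)^{2k}}=\sum_{N\ge n_k\ge\cdots\ge n_1\ge1}\frac{q^{n_1+n_2+\cdots+n_k}}{(1-q^{n_1})^2(1-q^{n_2})^2\cdots(1-q^{n_k})^2}.$$
   Context: $(a)_n=(a;q)_n=\prod_{i=0}^{n-1}(1-aq^i)$, $(a)_0=1$. -}

module Defs where

open import Data.Nat as ℕ using (ℕ; zero; suc; _∸_)
open import Data.Rational using (ℚ; 0ℚ; 1ℚ; _+_; _*_; -_; _-_; 1/_; ≢-nonZero)
open import Data.Rational.Properties using (_≟_)
open import Relation.Nullary using (yes; no)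

pow : ℚ → ℕ → ℚ
pow x zero    = 1ℚ
pow x (suc n) = pow x n * x

-- total reciprocal: inv 0 = 0, inv x = 1/x otherwise
-- (only ever applied to nonzero arguments under the theorem's hypotheses)
inv : ℚ → ℚ
inv x with x ≟ 0ℚ
... | yes _  = 0ℚ
... | no x≢0 = 1/_ x {{≢-nonZero x≢0}}

qpoch : ℚ → ℚ → ℕ → ℚ
qpoch a q zero    = 1ℚ
qpoch a q (suc n) = qpoch a q n * (1ℚ - a * pow q n)

qf : ℚ → ℕ → ℚ
qf q n = qpoch q q n

sum1 : ℕ → (ℕ → ℚ) → ℚ
sum1 zero    g = 0ℚ
sum1 (suc n) g = sum1 n g + g (suc n)

lhsTerm : ℚ → ℕ → ℕ → ℕ → ℚ
lhsTerm q N k r =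
  pow (- 1ℚ) (r ∸ 1) * pow q (r ℕ.* (r ∸ 1) ℕ./ 2 ℕ.+ k ℕ.* r) * (1ℚ + pow q r)
  * inv (qf q (N ∸ r) * qf q (N ℕ.+ r) * pow (1ℚ - pow q r) (2 ℕ.* k))

LHS : ℚ → ℕ → ℕ → ℚ
LHS q N k = pow (qf q N) 2 * sum1 N (lhsTerm q N k)

rhsFactor : ℚ → ℕ → ℚ
rhsFactor q n = pow q n * inv (pow (1ℚ - pow q n) 2)

-- chainSum q j m = Σ_{m ≥ n_j ≥ ... ≥ n_1 ≥ 1} ∏_{i=1}^{j} f(n_i)
chainSum : ℚ → ℕ → ℕ → ℚ
chainSum q zero    m = 1ℚ
chainSum q (suc j) m = sum1 m (λ n → rhsFactor q n * chainSum q j n)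

RHS : ℚ → ℕ → ℕ → ℚ
RHS q N k = chainSum q k N

module Submission where

-- Write the left side as S(N,k) = Σ_{r=1}^{N} c_k(r) w_N(r), where
-- c_k(r) = (-1)^{r-1} q^{r(r-1)/2+kr} (1+q^r) / (1-q^r)^{2k} does not depend on N and
-- w_N(r) = (q)_N² / ((q)_{N-r} (q)_{N+r}) does not depend on k. With f(n) = q^n / (1-q^n)²
-- one has c_{k+1}(r) = c_k(r) f(r), and w_{N+1}(r) (f(r) - f(N+1)) = w_N(r) f(r) for r ≤ N.
-- Hence S(N+1,k+1) = S(N,k+1) + f(N+1) S(N+1,k), which is the recursion defining the
-- chain sum on the right, and it remains to show S(N,0) = 1. For q ≠ 0 this is Rothe's
-- q-binomial theorem Σ_i (-1)^i q^{i(i-1)/2} [n,i]_q w^{n-i} = ∏_{j<n} (w - q^j) at n = 2N and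
-- w = q^N: the product vanishes, and the terms i = N ± r combine into a common factor times
-- c_0(r) / ((q)_{N-r} (q)_{N+r}). For q = 0 only the term r = 1 survives.

open import Defs
open import Data.Nat using (ℕ; _≤_)
open import Data.Rational using (ℚ; 1ℚ; -_)
open import Relation.Binary.PropositionalEquality using (_≡_; _≢_)

open import Relation.Binary.PropositionalEquality using (refl; sym; trans; cong; cong₂; subst; module ≡-Reasoning)
open import Function using (_∘_)

module _ where
  open import Data.Nat using (zero; suc; _+_; _*_; _∸_; _/_)
  open import Data.Nat.Properties using (m∸n+n≡m; m+n∸m≡n; +-identityʳ)
  open import Data.Nat.DivMod using (m*n/n≡m)
  open import Data.Nat.Solver using (module +-*-Solver)
  open +-*-Solver
  open ≡-Reasoning

  tri : ℕ → ℕ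
  tri zero    = 0
  tri (suc n) = tri n + n

  tri*2+n≡n*n : ∀ n → tri n * 2 + n ≡ n * n
  tri*2+n≡n*n zero    = refl
  tri*2+n≡n*n (suc n) = begin
    (tri n + n) * 2 + suc n
      ≡⟨ solve 2 (λ t n → (t :+ n) :* con 2 :+ (con 1 :+ n) := t :* con 2 :+ n :+ (con 1 :+ n :+ n)) refl (tri n) n ⟩
    tri n * 2 + n + (suc n + n)
      ≡⟨ cong (_+ (suc n + n)) (tri*2+n≡n*n n) ⟩
    n * n + (suc n + n)
      ≡⟨ solve 1 (λ n → n :* n :+ (con 1 :+ n :+ n) := (con 1 :+ n) :* (con 1 :+ n)) refl n ⟩
    suc n * suc n ∎

  n*[n∸1]/2≡tri : ∀ n → n * (n ∸ 1) / 2 ≡ tri n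
  n*[n∸1]/2≡tri zero    = refl
  n*[n∸1]/2≡tri (suc n) = trans (cong (_/ 2) (sym tri[1+n]*2)) (m*n/n≡m (tri (suc n)) 2)
    where
    tri[1+n]*2 : tri (suc n) * 2 ≡ suc n * n
    tri[1+n]*2 = begin
      (tri n + n) * 2      ≡⟨ solve 2 (λ t n → (t :+ n) :* con 2 := t :* con 2 :+ n :+ n) refl (tri n) n ⟩
      tri n * 2 + n + n    ≡⟨ cong (_+ n) (tri*2+n≡n*n n) ⟩
      n * n + n            ≡⟨ solve 1 (λ n → n :* n :+ n := (con 1 :+ n) :* n) refl n ⟩
      suc n * n            ∎

  tri-+ : ∀ m n → tri (m + n) ≡ tri m + tri n + m * n
  tri-+ zero    n = sym (+-identityʳ (tri n))
  tri-+ (suc m) n = begin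
    tri (m + n) + (m + n)
      ≡⟨ cong (_+ (m + n)) (tri-+ m n) ⟩
    tri m + tri n + m * n + (m + n)
      ≡⟨ solve 4 (λ s t m n → s :+ t :+ m :* n :+ (m :+ n) := s :+ m :+ t :+ (con 1 :+ m) :* n) refl (tri m) (tri n) m n ⟩
    tri m + m + tri n + suc m * n ∎

  tri[m+r]+m*[m∸r]≡tri[m]+m*m+tri[r] : ∀ {m r} → r ≤ m → tri (m + r) + m * (m ∸ r) ≡ tri m + m * m + tri r
  tri[m+r]+m*[m∸r]≡tri[m]+m*m+tri[r] {m} {r} r≤m with m ∸ r | m∸n+n≡m r≤m
  ... | d | refl = begin
    tri (d + r + r) + (d + r) * d
      ≡⟨ cong (_+ (d + r) * d) (tri-+ (d + r) r) ⟩
    tri (d + r) + tri r + (d + r) * r + (d + r) * d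
      ≡⟨ solve 4 (λ s t d r → s :+ t :+ (d :+ r) :* r :+ (d :+ r) :* d := s :+ (d :+ r) :* (d :+ r) :+ t) refl (tri (d + r)) (tri r) d r ⟩
    tri (d + r) + (d + r) * (d + r) + tri r ∎

  tri[m∸r]+m*[m+r]≡tri[m]+m*m+tri[r]+r : ∀ {m r} → r ≤ m → tri (m ∸ r) + m * (m + r) ≡ tri m + m * m + tri r + r
  tri[m∸r]+m*[m+r]≡tri[m]+m*m+tri[r]+r {m} {r} r≤m with m ∸ r | m∸n+n≡m r≤m
  ... | d | refl = begin
    tri d + (d + r) * (d + r + r)
      ≡⟨ solve 3 (λ s d r → s :+ (d :+ r) :* (d :+ r :+ r) := s :+ d :* r :+ (d :+ r) :* (d :+ r) :+ r :* r) refl (tri d) d r ⟩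
    tri d + d * r + (d + r) * (d + r) + r * r
      ≡⟨ cong (tri d + d * r + (d + r) * (d + r) +_) (sym (tri*2+n≡n*n r)) ⟩
    tri d + d * r + (d + r) * (d + r) + (tri r * 2 + r)
      ≡⟨ solve 5 (λ s t d r u → s :+ d :* r :+ u :+ (t :* con 2 :+ r) := s :+ t :+ d :* r :+ u :+ t :+ r)
           refl (tri d) (tri r) d r ((d + r) * (d + r)) ⟩
    tri d + tri r + d * r + (d + r) * (d + r) + tri r + r
      ≡⟨ cong (λ t → t + (d + r) * (d + r) + tri r + r) (sym (tri-+ d r)) ⟩
    tri (d + r) + (d + r) * (d + r) + tri r + r ∎

  m+m∸[m∸r]≡m+r : ∀ {m r} → r ≤ m → m + m ∸ (m ∸ r) ≡ m + r
  m+m∸[m∸r]≡m+r {m} {r} r≤m with m ∸ r | m∸n+n≡m r≤m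
  ... | d | refl = begin
    d + r + (d + r) ∸ d    ≡⟨ cong (_∸ d) (solve 2 (λ d r → d :+ r :+ (d :+ r) := d :+ (d :+ r :+ r)) refl d r) ⟩
    d + (d + r + r) ∸ d    ≡⟨ m+n∸m≡n d (d + r + r) ⟩
    d + r + r              ∎

open import Data.Nat as ℕ using (zero; suc; _∸_; z≤n; s≤s)
import Data.Nat.Properties as ℕ
open import Data.Rational using (0ℚ; _+_; _*_; _-_; ∣_∣; NonNegative; ≢-nonZero)
  renaming (_≤_ to _≤ℚ_)
open import Data.Rational.Properties
open import Data.Rational.Solver using (module +-*-Solver)
open +-*-Solver
open import Algebra.Bundles using (CommutativeRing)
open import Algebra.Properties.Group (CommutativeRing.+-group +-*-commutativeRing) using (x∙y⁻¹≈ε⇒x≈y; ⁻¹-involutive)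
open import Algebra.Properties.CommutativeSemiring.Exp (CommutativeRing.commutativeSemiring +-*-commutativeRing)
  using (_^_; ^-homo-*; ^-assocʳ; ^-distrib-*)
open import Data.Sum using (inj₁; inj₂)
open import Relation.Binary.Definitions using (tri<; tri≈; tri>)
open import Relation.Nullary using (Dec; yes; no; contradiction)
open ≡-Reasoning

pow≡^ : ∀ x n → pow x n ≡ x ^ n
pow≡^ x zero    = refl
pow≡^ x (suc n) = trans (cong (_* x) (pow≡^ x n)) (*-comm (x ^ n) x)

pow-+ : ∀ x m n → pow x (m ℕ.+ n) ≡ pow x m * pow x n
pow-+ x m n rewrite pow≡^ x (m ℕ.+ n) | pow≡^ x m | pow≡^ x n = ^-homo-* x m n

pow-distrib-* : ∀ x y n → pow (x * y) n ≡ pow x n * pow y n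
pow-distrib-* x y n rewrite pow≡^ (x * y) n | pow≡^ x n | pow≡^ y n = ^-distrib-* x y n

pow-pow : ∀ x m n → pow (pow x m) n ≡ pow x (m ℕ.* n)
pow-pow x m n rewrite pow≡^ (pow x m) n | pow≡^ x m | pow≡^ x (m ℕ.* n) = ^-assocʳ x m n

pow[-1]*pow[-1] : ∀ r → pow (- 1ℚ) r * pow (- 1ℚ) r ≡ 1ℚ
pow[-1]*pow[-1] zero    = refl
pow[-1]*pow[-1] (suc r) =
  trans (solve 1 (λ s → s :* (:- con 1ℚ) :* (s :* (:- con 1ℚ)) := s :* s) refl (pow (- 1ℚ) r)) (pow[-1]*pow[-1] r)

pow[-1]-∸ : ∀ {n r} → r ≤ n → pow (- 1ℚ) (n ∸ r) ≡ pow (- 1ℚ) n * pow (- 1ℚ) r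
pow[-1]-∸ {n} {r} r≤n = begin
  σ (n ∸ r)                    ≡⟨ sym (*-identityʳ (σ (n ∸ r))) ⟩
  σ (n ∸ r) * 1ℚ               ≡⟨ cong (σ (n ∸ r) *_) (sym (pow[-1]*pow[-1] r)) ⟩
  σ (n ∸ r) * (σ r * σ r)      ≡⟨ sym (*-assoc (σ (n ∸ r)) (σ r) (σ r)) ⟩
  σ (n ∸ r) * σ r * σ r        ≡⟨ cong (_* σ r) (sym (pow-+ (- 1ℚ) (n ∸ r) r)) ⟩
  σ (n ∸ r ℕ.+ r) * σ r        ≡⟨ cong (λ m → σ m * σ r) (ℕ.m∸n+n≡m r≤n) ⟩
  σ n * σ r                    ∎
  where
  σ : ℕ → ℚ
  σ = pow (- 1ℚ)

*-inverseʳ-inv : ∀ {x} → x ≢ 0ℚ → x * inv x ≡ 1ℚ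
*-inverseʳ-inv {x} x≢0 with x ≟ 0ℚ
... | yes x≡0  = contradiction x≡0 x≢0
... | no  x≢0′ = *-inverseʳ x {{≢-nonZero x≢0′}}

*-cancelˡ-≡0 : ∀ {x y} → x ≢ 0ℚ → x * y ≡ 0ℚ → y ≡ 0ℚ
*-cancelˡ-≡0 {x} {y} x≢0 xy≡0 = begin
  y                   ≡⟨ sym (*-identityˡ y) ⟩
  1ℚ * y              ≡⟨ cong (_* y) (sym (trans (*-comm (inv x) x) (*-inverseʳ-inv x≢0))) ⟩
  inv x * x * y       ≡⟨ *-assoc (inv x) x y ⟩
  inv x * (x * y)     ≡⟨ cong (inv x *_) xy≡0 ⟩
  inv x * 0ℚ          ≡⟨ *-zeroʳ (inv x) ⟩
  0ℚ                  ∎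

*-≢0 : ∀ {x y} → x ≢ 0ℚ → y ≢ 0ℚ → x * y ≢ 0ℚ
*-≢0 x≢0 y≢0 xy≡0 = y≢0 (*-cancelˡ-≡0 x≢0 xy≡0)

pow≢0 : ∀ {x} n → x ≢ 0ℚ → pow x n ≢ 0ℚ
pow≢0 zero    x≢0 ()
pow≢0 (suc n) x≢0 = *-≢0 (pow≢0 n x≢0) x≢0

inv-unique : ∀ {x y} → x * y ≡ 1ℚ → inv x ≡ y
inv-unique {x} {y} xy≡1 = begin
  inv x                ≡⟨ sym (*-identityʳ (inv x)) ⟩
  inv x * 1ℚ           ≡⟨ cong (inv x *_) (sym xy≡1) ⟩
  inv x * (x * y)      ≡⟨ sym (*-assoc (inv x) x y) ⟩
  inv x * x * y        ≡⟨ cong (_* y) (trans (*-comm (inv x) x) (*-inverseʳ-inv x≢0)) ⟩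
  1ℚ * y               ≡⟨ *-identityˡ y ⟩
  y                    ∎
  where
  x≢0 : x ≢ 0ℚ
  x≢0 refl = contradiction (trans (sym (*-zeroˡ y)) xy≡1) λ ()

inv-≡0 : ∀ {x} → x ≡ 0ℚ → inv x ≡ 0ℚ
inv-≡0 refl = refl

-- No hypotheses are needed because inv 0ℚ ≡ 0ℚ.
inv-* : ∀ x y → inv (x * y) ≡ inv x * inv y
inv-* x y = by-cases (x ≟ 0ℚ) (y ≟ 0ℚ)
  where
  by-cases : Dec (x ≡ 0ℚ) → Dec (y ≡ 0ℚ) → inv (x * y) ≡ inv x * inv y
  by-cases (yes x≡0) _ = begin
    inv (x * y)      ≡⟨ inv-≡0 (trans (cong (_* y) x≡0) (*-zeroˡ y)) ⟩
    0ℚ               ≡⟨ sym (*-zeroˡ (inv y)) ⟩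
    0ℚ * inv y       ≡⟨ cong (_* inv y) (sym (inv-≡0 x≡0)) ⟩
    inv x * inv y    ∎
  by-cases (no _) (yes y≡0) = begin
    inv (x * y)      ≡⟨ inv-≡0 (trans (cong (x *_) y≡0) (*-zeroʳ x)) ⟩
    0ℚ               ≡⟨ sym (*-zeroʳ (inv x)) ⟩
    inv x * 0ℚ       ≡⟨ cong (inv x *_) (sym (inv-≡0 y≡0)) ⟩
    inv x * inv y    ∎
  by-cases (no x≢0) (no y≢0) = inv-unique {x * y} (begin
    x * y * (inv x * inv y)      ≡⟨ solve 4 (λ x y i j → x :* y :* (i :* j) := (x :* i) :* (y :* j)) refl x y (inv x) (inv y) ⟩
    (x * inv x) * (y * inv y)    ≡⟨ cong₂ _*_ (*-inverseʳ-inv x≢0) (*-inverseʳ-inv y≢0) ⟩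
    1ℚ                           ∎)

x*y≡z⇒x≡z*inv[y] : ∀ {x y z} → x * y ≡ z → y ≢ 0ℚ → x ≡ z * inv y
x*y≡z⇒x≡z*inv[y] {x} {y} {z} xy≡z y≢0 = begin
  x                 ≡⟨ sym (*-identityʳ x) ⟩
  x * 1ℚ            ≡⟨ cong (x *_) (sym (*-inverseʳ-inv y≢0)) ⟩
  x * (y * inv y)   ≡⟨ sym (*-assoc x y (inv y)) ⟩
  x * y * inv y     ≡⟨ cong (_* inv y) xy≡z ⟩
  z * inv y         ∎

sum1-cong : ∀ n {f g : ℕ → ℚ} → (∀ r → 1 ≤ r → r ≤ n → f r ≡ g r) → sum1 n f ≡ sum1 n g
sum1-cong zero    f≗g = refl
sum1-cong (suc n) f≗g =
  cong₂ _+_ (sum1-cong n λ r 1≤r r≤n → f≗g r 1≤r (ℕ.m≤n⇒m≤1+n r≤n)) (f≗g (suc n) (s≤s z≤n) ℕ.≤-refl)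

sum1-distrib-+ : ∀ n (f g : ℕ → ℚ) → sum1 n (λ r → f r + g r) ≡ sum1 n f + sum1 n g
sum1-distrib-+ zero    f g = refl
sum1-distrib-+ (suc n) f g = begin
  sum1 n (λ r → f r + g r) + (f (suc n) + g (suc n))
    ≡⟨ cong (_+ (f (suc n) + g (suc n))) (sum1-distrib-+ n f g) ⟩
  sum1 n f + sum1 n g + (f (suc n) + g (suc n))
    ≡⟨ solve 4 (λ a b c d → a :+ b :+ (c :+ d) := a :+ c :+ (b :+ d)) refl (sum1 n f) (sum1 n g) (f (suc n)) (g (suc n)) ⟩
  sum1 n f + f (suc n) + (sum1 n g + g (suc n)) ∎

*-distribˡ-sum1 : ∀ n c (f : ℕ → ℚ) → c * sum1 n f ≡ sum1 n (λ r → c * f r)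
*-distribˡ-sum1 zero    c f = *-zeroʳ c
*-distribˡ-sum1 (suc n) c f = trans (*-distribˡ-+ c (sum1 n f) (f (suc n))) (cong (_+ c * f (suc n)) (*-distribˡ-sum1 n c f))

sum1-0 : ∀ n → sum1 n (λ _ → 0ℚ) ≡ 0ℚ
sum1-0 zero    = refl
sum1-0 (suc n) = trans (+-identityʳ _) (sum1-0 n)

sum1-suc : ∀ n (g : ℕ → ℚ) → sum1 (suc n) g ≡ g 1 + sum1 n (λ r → g (suc r))
sum1-suc zero    g = +-comm 0ℚ (g 1)
sum1-suc (suc n) g = begin
  sum1 (suc n) g + g (suc (suc n))                  ≡⟨ cong (_+ g (suc (suc n))) (sum1-suc n g) ⟩
  g 1 + sum1 n (λ r → g (suc r)) + g (suc (suc n))  ≡⟨ +-assoc (g 1) _ _ ⟩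
  g 1 + sum1 (suc n) (λ r → g (suc r))              ∎

sum1-+ : ∀ m n (g : ℕ → ℚ) → sum1 (m ℕ.+ n) g ≡ sum1 m g + sum1 n (λ r → g (m ℕ.+ r))
sum1-+ m zero    g = trans (cong (λ k → sum1 k g) (ℕ.+-identityʳ m)) (sym (+-identityʳ (sum1 m g)))
sum1-+ m (suc n) g = begin
  sum1 (m ℕ.+ suc n) g                                       ≡⟨ cong (λ k → sum1 k g) (ℕ.+-suc m n) ⟩
  sum1 (m ℕ.+ n) g + g (suc (m ℕ.+ n))                       ≡⟨ cong₂ _+_ (sum1-+ m n g) (cong g (sym (ℕ.+-suc m n))) ⟩
  sum1 m g + sum1 n (λ r → g (m ℕ.+ r)) + g (m ℕ.+ suc n)    ≡⟨ +-assoc (sum1 m g) _ _ ⟩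
  sum1 m g + sum1 (suc n) (λ r → g (m ℕ.+ r))                ∎

sum0 : ℕ → (ℕ → ℚ) → ℚ
sum0 n g = g 0 + sum1 n g

sum0-reverse : ∀ n (g : ℕ → ℚ) → sum0 n g ≡ g n + sum1 n (λ r → g (n ∸ r))
sum0-reverse zero    g = refl
sum0-reverse (suc n) g = begin
  g 0 + (sum1 n g + g (suc n))
    ≡⟨ solve 3 (λ a b c → a :+ (b :+ c) := c :+ (a :+ b)) refl (g 0) (sum1 n g) (g (suc n)) ⟩
  g (suc n) + sum0 n g
    ≡⟨ cong (g (suc n) +_) (sum0-reverse n g) ⟩
  g (suc n) + (g n + sum1 n (λ r → g (n ∸ r)))
    ≡⟨ cong (g (suc n) +_) (sym (sum1-suc n (λ r → g (suc n ∸ r)))) ⟩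
  g (suc n) + sum1 (suc n) (λ r → g (suc n ∸ r)) ∎

sum0-symmetric : ∀ N (g : ℕ → ℚ) → sum0 (N ℕ.+ N) g ≡ g N + sum1 N (λ r → g (N ∸ r) + g (N ℕ.+ r))
sum0-symmetric N g = begin
  g 0 + sum1 (N ℕ.+ N) g                                           ≡⟨ cong (g 0 +_) (sum1-+ N N g) ⟩
  g 0 + (sum1 N g + sum1 N (λ r → g (N ℕ.+ r)))                    ≡⟨ sym (+-assoc (g 0) (sum1 N g) _) ⟩
  sum0 N g + sum1 N (λ r → g (N ℕ.+ r))                            ≡⟨ cong (_+ sum1 N (λ r → g (N ℕ.+ r))) (sum0-reverse N g) ⟩
  g N + sum1 N (λ r → g (N ∸ r)) + sum1 N (λ r → g (N ℕ.+ r))      ≡⟨ +-assoc (g N) _ _ ⟩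
  g N + (sum1 N (λ r → g (N ∸ r)) + sum1 N (λ r → g (N ℕ.+ r)))    ≡⟨ cong (g N +_) (sym (sum1-distrib-+ N _ _)) ⟩
  g N + sum1 N (λ r → g (N ∸ r) + g (N ℕ.+ r))                     ∎

pow≤1 : ∀ a .{{_ : NonNegative a}} → a ≤ℚ 1ℚ → ∀ n → pow a n ≤ℚ 1ℚ
pow≤1 a a≤1 zero    = ≤-refl
pow≤1 a a≤1 (suc n) = ≤-trans (*-monoʳ-≤-nonNeg a (pow≤1 a a≤1 n)) (≤-trans (≤-reflexive (*-identityˡ a)) a≤1)

1≤pow : ∀ a .{{_ : NonNegative a}} → 1ℚ ≤ℚ a → ∀ n → 1ℚ ≤ℚ pow a n
1≤pow a 1≤a zero    = ≤-refl
1≤pow a 1≤a (suc n) = ≤-trans 1≤a (≤-trans (≤-reflexive (sym (*-identityˡ a))) (*-monoʳ-≤-nonNeg a (1≤pow a 1≤a n)))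

pow[1+n]≡1⇒≡1 : ∀ a .{{_ : NonNegative a}} n → pow a (suc n) ≡ 1ℚ → a ≡ 1ℚ
pow[1+n]≡1⇒≡1 a n aⁿ⁺¹≡1 with <-cmp a 1ℚ
... | tri< a<1 _ _ = contradiction aⁿ⁺¹≡1
  (<⇒≢ (≤-<-trans (≤-trans (*-monoʳ-≤-nonNeg a (pow≤1 a (<⇒≤ a<1) n)) (≤-reflexive (*-identityˡ a))) a<1))
... | tri≈ _ a≡1 _ = a≡1
... | tri> _ _ 1<a = contradiction (sym aⁿ⁺¹≡1)
  (<⇒≢ (<-≤-trans 1<a (≤-trans (≤-reflexive (sym (*-identityˡ a))) (*-monoʳ-≤-nonNeg a (1≤pow a (<⇒≤ 1<a) n)))))

∣pow∣ : ∀ x n → ∣ pow x n ∣ ≡ pow ∣ x ∣ n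
∣pow∣ x zero    = refl
∣pow∣ x (suc n) = trans (∣p*q∣≡∣p∣*∣q∣ (pow x n) x) (cong (_* ∣ x ∣) (∣pow∣ x n))

fraction-difference : ∀ u v {x y} → x ≢ 0ℚ → y ≢ 0ℚ → u * inv x - v * inv y ≡ (u * y - v * x) * inv (x * y)
fraction-difference u v {x} {y} x≢0 y≢0 = sym (begin
  (u * y - v * x) * inv (x * y)
    ≡⟨ cong ((u * y - v * x) *_) (inv-* x y) ⟩
  (u * y - v * x) * (inv x * inv y)
    ≡⟨ solve 6 (λ u v x y i j → (u :* y :- v :* x) :* (i :* j) := u :* i :* (y :* j) :- v :* j :* (x :* i)) refl u v x y (inv x) (inv y) ⟩
  u * inv x * (y * inv y) - v * inv y * (x * inv x)
    ≡⟨ cong₂ (λ a b → u * inv x * a - v * inv y * b) (*-inverseʳ-inv y≢0) (*-inverseʳ-inv x≢0) ⟩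
  u * inv x * 1ℚ - v * inv y * 1ℚ
    ≡⟨ cong₂ _-_ (*-identityʳ (u * inv x)) (*-identityʳ (v * inv y)) ⟩
  u * inv x - v * inv y ∎)

x/[1-x]² : ℚ → ℚ
x/[1-x]² x = x * inv (pow (1ℚ - x) 2)

x/[1-x]²-difference : ∀ {a b} → 1ℚ - a ≢ 0ℚ → 1ℚ - b ≢ 0ℚ →
  x/[1-x]² a - x/[1-x]² b ≡ (a - b) * (1ℚ - a * b) * inv (pow (1ℚ - a) 2 * pow (1ℚ - b) 2)
x/[1-x]²-difference {a} {b} 1-a≢0 1-b≢0 = begin
  x/[1-x]² a - x/[1-x]² b
    ≡⟨ fraction-difference a b (pow≢0 2 1-a≢0) (pow≢0 2 1-b≢0) ⟩
  (a * pow (1ℚ - b) 2 - b * pow (1ℚ - a) 2) * inv (pow (1ℚ - a) 2 * pow (1ℚ - b) 2)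
    ≡⟨ cong (_* inv (pow (1ℚ - a) 2 * pow (1ℚ - b) 2))
         (solve 2 (λ a b → a :* (con 1ℚ :* (con 1ℚ :- b) :* (con 1ℚ :- b)) :- b :* (con 1ℚ :* (con 1ℚ :- a) :* (con 1ℚ :- a))
                           := (a :- b) :* (con 1ℚ :- a :* b)) refl a b) ⟩
  (a - b) * (1ℚ - a * b) * inv (pow (1ℚ - a) 2 * pow (1ℚ - b) 2) ∎

-- The passage N ↦ N + 1 in weight-suc, with a = q^r, b = q^{N+1} and c = q^{N+1-r}.
x/[1-x]²-step : ∀ {a b c} → c * a ≡ b → 1ℚ - a ≢ 0ℚ → 1ℚ - b ≢ 0ℚ → 1ℚ - c ≢ 0ℚ → 1ℚ - a * b ≢ 0ℚ →
  pow (1ℚ - b) 2 * inv ((1ℚ - c) * (1ℚ - a * b)) * (x/[1-x]² a - x/[1-x]² b) ≡ x/[1-x]² a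
x/[1-x]²-step {a} {b} {c} ca≡b 1-a≢0 1-b≢0 1-c≢0 1-ab≢0 = begin
  B² * inv (C * D) * (x/[1-x]² a - x/[1-x]² b)
    ≡⟨ cong (B² * inv (C * D) *_) (x/[1-x]²-difference {a} {b} 1-a≢0 1-b≢0) ⟩
  B² * inv (C * D) * ((a - b) * D * inv (A² * B²))
    ≡⟨ cong₂ (λ x y → B² * inv (C * D) * ((a - x) * D * y)) (sym ca≡b) (inv-* A² B²) ⟩
  B² * inv (C * D) * ((a - c * a) * D * (inv A² * inv B²))
    ≡⟨ solve 7 (λ a c D B² i iA iB → B² :* i :* ((a :- c :* a) :* D :* (iA :* iB))
                 := a :* iA :* (((con 1ℚ :- c) :* D) :* i) :* (B² :* iB)) refl a c D B² (inv (C * D)) (inv A²) (inv B²) ⟩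
  a * inv A² * ((C * D) * inv (C * D)) * (B² * inv B²)
    ≡⟨ cong₂ (λ x y → a * inv A² * x * y) (*-inverseʳ-inv (*-≢0 1-c≢0 1-ab≢0)) (*-inverseʳ-inv (pow≢0 2 1-b≢0)) ⟩
  a * inv A² * 1ℚ * 1ℚ
    ≡⟨ solve 2 (λ a i → a :* i :* con 1ℚ :* con 1ℚ := a :* i) refl a (inv A²) ⟩
  x/[1-x]² a ∎
  where
  A² B² C D : ℚ
  A² = pow (1ℚ - a) 2
  B² = pow (1ℚ - b) 2
  C  = 1ℚ - c
  D  = 1ℚ - a * b

module _ (q : ℚ) where

  qf-suc : ∀ n → qf q (suc n) ≡ qf q n * (1ℚ - pow q (suc n))
  qf-suc n = cong (λ t → qf q n * (1ℚ - t)) (*-comm q (pow q n))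

  qbinom : ℕ → ℕ → ℚ
  qbinom n       zero    = 1ℚ
  qbinom zero    (suc k) = 0ℚ
  qbinom (suc n) (suc k) = qbinom n (suc k) + pow q (n ∸ k) * qbinom n k

  qbinom-vanish : ∀ {n k} → n ℕ.< k → qbinom n k ≡ 0ℚ
  qbinom-vanish {zero}  {suc k} _         = refl
  qbinom-vanish {suc n} {suc k} (s≤s n<k) = begin
    qbinom n (suc k) + pow q (n ∸ k) * qbinom n k
      ≡⟨ cong₂ (λ a b → a + pow q (n ∸ k) * b) (qbinom-vanish (ℕ.m≤n⇒m≤1+n n<k)) (qbinom-vanish n<k) ⟩
    0ℚ + pow q (n ∸ k) * 0ℚ
      ≡⟨ solve 1 (λ p → con 0ℚ :+ p :* con 0ℚ := con 0ℚ) refl (pow q (n ∸ k)) ⟩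
    0ℚ ∎

  qbinom*qf*qf : ∀ {n k} → k ≤ n → qbinom n k * qf q k * qf q (n ∸ k) ≡ qf q n
  qbinom*qf*qf {n}     {zero}  _         = solve 1 (λ f → con 1ℚ :* con 1ℚ :* f := f) refl (qf q n)
  qbinom*qf*qf {suc n} {suc k} (s≤s k≤n) = begin
    (qbinom n (suc k) + p * qbinom n k) * qf q (suc k) * qf q (n ∸ k)
      ≡⟨ cong (λ t → (qbinom n (suc k) + p * qbinom n k) * t * qf q (n ∸ k)) (qf-suc k) ⟩
    (qbinom n (suc k) + p * qbinom n k) * (qf q k * c) * qf q (n ∸ k)
      ≡⟨ solve 6 (λ b₁ p b₀ f c g → (b₁ :+ p :* b₀) :* (f :* c) :* g := b₁ :* (f :* c) :* g :+ p :* (b₀ :* f :* g) :* c)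
           refl (qbinom n (suc k)) p (qbinom n k) (qf q k) c (qf q (n ∸ k)) ⟩
    qbinom n (suc k) * (qf q k * c) * qf q (n ∸ k) + p * (qbinom n k * qf q k * qf q (n ∸ k)) * c
      ≡⟨ cong₂ (λ a b → a + p * b * c) (trans (cong (λ t → qbinom n (suc k) * t * qf q (n ∸ k)) (sym (qf-suc k))) upper) (qbinom*qf*qf k≤n) ⟩
    qf q n * (1ℚ - p) + p * qf q n * (1ℚ - pow q (suc k))
      ≡⟨ solve 3 (λ f p a → f :* (con 1ℚ :- p) :+ p :* f :* (con 1ℚ :- a) := f :* (con 1ℚ :- p :* a)) refl (qf q n) p (pow q (suc k)) ⟩
    qf q n * (1ℚ - p * pow q (suc k))
      ≡⟨ cong (λ t → qf q n * (1ℚ - t)) (trans (sym (pow-+ q (n ∸ k) (suc k))) (cong (pow q) n∸k+[1+k]≡1+n)) ⟩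
    qf q n * (1ℚ - pow q (suc n))
      ≡⟨ sym (qf-suc n) ⟩
    qf q (suc n) ∎
    where
    p c : ℚ
    p = pow q (n ∸ k)
    c = 1ℚ - pow q (suc k)
    n∸k+[1+k]≡1+n : n ∸ k ℕ.+ suc k ≡ suc n
    n∸k+[1+k]≡1+n = trans (ℕ.+-suc (n ∸ k) k) (cong suc (ℕ.m∸n+n≡m k≤n))
    upper : qbinom n (suc k) * qf q (suc k) * qf q (n ∸ k) ≡ qf q n * (1ℚ - p)
    upper with ℕ.m≤n⇒m<n∨m≡n k≤n
    ... | inj₁ k<n = begin
      qbinom n (suc k) * qf q (suc k) * qf q (n ∸ k)
        ≡⟨ cong (λ m → qbinom n (suc k) * qf q (suc k) * qf q m) (ℕ.+-∸-assoc 1 {n} {suc k} k<n) ⟩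
      qbinom n (suc k) * qf q (suc k) * qf q (suc (n ∸ suc k))
        ≡⟨ cong (qbinom n (suc k) * qf q (suc k) *_) (qf-suc (n ∸ suc k)) ⟩
      qbinom n (suc k) * qf q (suc k) * (qf q (n ∸ suc k) * (1ℚ - pow q (suc (n ∸ suc k))))
        ≡⟨ sym (*-assoc (qbinom n (suc k) * qf q (suc k)) (qf q (n ∸ suc k)) _) ⟩
      qbinom n (suc k) * qf q (suc k) * qf q (n ∸ suc k) * (1ℚ - pow q (suc (n ∸ suc k)))
        ≡⟨ cong₂ (λ a m → a * (1ℚ - pow q m)) (qbinom*qf*qf k<n) (sym (ℕ.+-∸-assoc 1 {n} {suc k} k<n)) ⟩
      qf q n * (1ℚ - p) ∎
    ... | inj₂ refl = begin
      qbinom k (suc k) * qf q (suc k) * qf q (k ∸ k)   ≡⟨ cong (λ b → b * qf q (suc k) * qf q (k ∸ k)) (qbinom-vanish {k} ℕ.≤-refl) ⟩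
      0ℚ * qf q (suc k) * qf q (k ∸ k)                 ≡⟨ solve 2 (λ a b → con 0ℚ :* a :* b := con 0ℚ) refl (qf q (suc k)) (qf q (k ∸ k)) ⟩
      0ℚ                                               ≡⟨ solve 1 (λ f → con 0ℚ := f :* (con 1ℚ :- con 1ℚ)) refl (qf q k) ⟩
      qf q k * (1ℚ - 1ℚ)                               ≡⟨ cong (λ m → qf q k * (1ℚ - pow q m)) (sym (ℕ.n∸n≡0 k)) ⟩
      qf q k * (1ℚ - pow q (k ∸ k))                    ∎

  rotheTerm : ℚ → ℕ → ℕ → ℚ
  rotheTerm w n i = pow (- 1ℚ) i * pow q (tri i) * pow w (n ∸ i) * qbinom n i

  rotheProduct : ℚ → ℕ → ℚ
  rotheProduct w zero    = 1ℚ
  rotheProduct w (suc n) = rotheProduct w n * (w - pow q n)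

  rotheTerm-suc : ∀ w {n i} → i ≤ n → rotheTerm w (suc n) (suc i) ≡ w * rotheTerm w n (suc i) + (- pow q n) * rotheTerm w n i
  rotheTerm-suc w {n} {i} i≤n = begin
    s * m * T * pow w (n ∸ i) * (qbinom n (suc i) + pow q (n ∸ i) * qbinom n i)
      ≡⟨ solve 7 (λ s m T W b₁ p b₀ → s :* m :* T :* W :* (b₁ :+ p :* b₀) := s :* m :* T :* (W :* b₁) :+ s :* m :* T :* W :* p :* b₀)
           refl s m T (pow w (n ∸ i)) (qbinom n (suc i)) (pow q (n ∸ i)) (qbinom n i) ⟩
    s * m * T * (pow w (n ∸ i) * qbinom n (suc i)) + s * m * T * pow w (n ∸ i) * pow q (n ∸ i) * qbinom n i
      ≡⟨ cong₂ (λ a b → s * m * T * a + s * m * b * pow w (n ∸ i) * pow q (n ∸ i) * qbinom n i) shift-power (pow-+ q (tri i) i) ⟩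
    s * m * T * (w * (pow w (n ∸ suc i) * qbinom n (suc i))) + s * m * (pow q (tri i) * pow q i) * pow w (n ∸ i) * pow q (n ∸ i) * qbinom n i
      ≡⟨ solve 10 (λ s T w W b₁ t a W′ p b₀ → s :* (:- con 1ℚ) :* T :* (w :* (W :* b₁)) :+ s :* (:- con 1ℚ) :* (t :* a) :* W′ :* p :* b₀
                    := w :* (s :* (:- con 1ℚ) :* T :* W :* b₁) :+ (:- (a :* p)) :* (s :* t :* W′ :* b₀))
           refl s T w (pow w (n ∸ suc i)) (qbinom n (suc i)) (pow q (tri i)) (pow q i) (pow w (n ∸ i)) (pow q (n ∸ i)) (qbinom n i) ⟩
    w * rotheTerm w n (suc i) + (- (pow q i * pow q (n ∸ i))) * rotheTerm w n i
      ≡⟨ cong (λ t → w * rotheTerm w n (suc i) + (- t) * rotheTerm w n i) (trans (sym (pow-+ q i (n ∸ i))) (cong (pow q) (ℕ.m+[n∸m]≡n i≤n))) ⟩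
    w * rotheTerm w n (suc i) + (- pow q n) * rotheTerm w n i ∎
    where
    s m T : ℚ
    s = pow (- 1ℚ) i
    m = - 1ℚ
    T = pow q (tri i ℕ.+ i)
    shift-power : pow w (n ∸ i) * qbinom n (suc i) ≡ w * (pow w (n ∸ suc i) * qbinom n (suc i))
    shift-power with ℕ.m≤n⇒m<n∨m≡n i≤n
    ... | inj₁ i<n = begin
      pow w (n ∸ i) * qbinom n (suc i)
        ≡⟨ cong (λ k → pow w k * qbinom n (suc i)) (ℕ.+-∸-assoc 1 {n} {suc i} i<n) ⟩
      pow w (n ∸ suc i) * w * qbinom n (suc i)
        ≡⟨ solve 3 (λ a w b → a :* w :* b := w :* (a :* b)) refl (pow w (n ∸ suc i)) w (qbinom n (suc i)) ⟩
      w * (pow w (n ∸ suc i) * qbinom n (suc i)) ∎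
    ... | inj₂ refl = begin
      pow w (n ∸ n) * qbinom n (suc n)
        ≡⟨ cong (pow w (n ∸ n) *_) (qbinom-vanish {n} ℕ.≤-refl) ⟩
      pow w (n ∸ n) * 0ℚ
        ≡⟨ solve 3 (λ a w c → a :* con 0ℚ := w :* (c :* con 0ℚ)) refl (pow w (n ∸ n)) w (pow w (n ∸ suc n)) ⟩
      w * (pow w (n ∸ suc n) * 0ℚ)
        ≡⟨ cong (λ b → w * (pow w (n ∸ suc n) * b)) (sym (qbinom-vanish {n} ℕ.≤-refl)) ⟩
      w * (pow w (n ∸ suc n) * qbinom n (suc n)) ∎


  rothe : ∀ w n → sum0 n (rotheTerm w n) ≡ rotheProduct w n
  rothe w zero    = refl
  rothe w (suc n) = begin
    t′ 0 + sum1 (suc n) t′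
      ≡⟨ cong₂ _+_ t′0≡w*t0 (sum1-cong (suc n) λ { (suc i) _ i+1≤n+1 → rotheTerm-suc w (ℕ.≤-pred i+1≤n+1) }) ⟩
    w * t 0 + sum1 (suc n) (λ i → w * t i + c * t (i ∸ 1))
      ≡⟨ cong (w * t 0 +_) (trans (sum1-distrib-+ (suc n) _ _) (sym (cong₂ _+_ (*-distribˡ-sum1 (suc n) w t) (*-distribˡ-sum1 (suc n) c (λ i → t (i ∸ 1)))))) ⟩
    w * t 0 + (w * (sum1 n t + t (suc n)) + c * sum1 (suc n) (λ i → t (i ∸ 1)))
      ≡⟨ cong₂ (λ a b → w * t 0 + (w * (sum1 n t + a) + c * b)) t[1+n]≡0 (sum1-suc n (λ i → t (i ∸ 1))) ⟩
    w * t 0 + (w * (sum1 n t + 0ℚ) + c * sum0 n t)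
      ≡⟨ solve 5 (λ w a b c S → w :* a :+ (w :* (b :+ con 0ℚ) :+ c :* S) := (a :+ b) :* w :+ c :* S) refl w (t 0) (sum1 n t) c (sum0 n t) ⟩
    sum0 n t * w + c * sum0 n t
      ≡⟨ solve 3 (λ S w p → S :* w :+ (:- p) :* S := S :* (w :- p)) refl (sum0 n t) w (pow q n) ⟩
    sum0 n t * (w - pow q n)
      ≡⟨ cong (_* (w - pow q n)) (rothe w n) ⟩
    rotheProduct w n * (w - pow q n) ∎
    where
    t t′ : ℕ → ℚ
    t  = rotheTerm w n
    t′ = rotheTerm w (suc n)
    c : ℚ
    c = - pow q n
    t′0≡w*t0 : t′ 0 ≡ w * t 0
    t′0≡w*t0 = solve 2 (λ W w → con 1ℚ :* con 1ℚ :* (W :* w) :* con 1ℚ := w :* (con 1ℚ :* con 1ℚ :* W :* con 1ℚ)) refl (pow w n) w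
    t[1+n]≡0 : t (suc n) ≡ 0ℚ
    t[1+n]≡0 = trans (cong (u *_) (qbinom-vanish {n} ℕ.≤-refl)) (*-zeroʳ u)
      where
      u : ℚ
      u = pow (- 1ℚ) (suc n) * pow q (tri (suc n)) * pow w (n ∸ suc n)

  rotheProduct-vanishes : ∀ {m n} → m ℕ.< n → rotheProduct (pow q m) n ≡ 0ℚ
  rotheProduct-vanishes {m} {suc n} m<1+n with ℕ.m≤n⇒m<n∨m≡n (ℕ.≤-pred m<1+n)
  ... | inj₁ m<n  = trans (cong (_* (pow q m - pow q n)) (rotheProduct-vanishes m<n)) (*-zeroˡ (pow q m - pow q n))
  ... | inj₂ refl = trans (cong (rotheProduct (pow q m) m *_) (+-inverseʳ (pow q m))) (*-zeroʳ (rotheProduct (pow q m) m))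

  coefficient : ℕ → ℕ → ℚ
  coefficient k r = pow (- 1ℚ) (r ∸ 1) * pow q (r ℕ.* (r ∸ 1) ℕ./ 2 ℕ.+ k ℕ.* r) * (1ℚ + pow q r)
                    * inv (pow (1ℚ - pow q r) (2 ℕ.* k))

  weight : ℕ → ℕ → ℚ
  weight N r = pow (qf q N) 2 * inv (qf q (N ∸ r) * qf q (N ℕ.+ r))

  lhsSum : ℕ → ℕ → ℚ
  lhsSum N k = sum1 N (λ r → coefficient k r * weight N r)

  LHS≡lhsSum : ∀ N k → LHS q N k ≡ lhsSum N k
  LHS≡lhsSum N k = trans (*-distribˡ-sum1 N (pow (qf q N) 2) (lhsTerm q N k)) (sum1-cong N λ r _ _ → factorise r)
    where
    factorise : ∀ r → pow (qf q N) 2 * lhsTerm q N k r ≡ coefficient k r * weight N r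
    factorise r = begin
      P * (s * inv (Q₋ * Q₊ * Y))
        ≡⟨ cong (λ t → P * (s * t)) (inv-* (Q₋ * Q₊) Y) ⟩
      P * (s * (inv (Q₋ * Q₊) * inv Y))
        ≡⟨ solve 4 (λ P s i j → P :* (s :* (i :* j)) := s :* j :* (P :* i)) refl P s (inv (Q₋ * Q₊)) (inv Y) ⟩
      s * inv Y * (P * inv (Q₋ * Q₊)) ∎
      where
      P s Q₋ Q₊ Y : ℚ
      P  = pow (qf q N) 2
      s  = pow (- 1ℚ) (r ∸ 1) * pow q (r ℕ.* (r ∸ 1) ℕ./ 2 ℕ.+ k ℕ.* r) * (1ℚ + pow q r)
      Q₋ = qf q (N ∸ r)
      Q₊ = qf q (N ℕ.+ r)
      Y  = pow (1ℚ - pow q r) (2 ℕ.* k)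

  coefficient-suc : ∀ k r → coefficient (suc k) r ≡ coefficient k r * rhsFactor q r
  coefficient-suc k r = begin
    σ * pow q (E ℕ.+ (r ℕ.+ k ℕ.* r)) * c * inv (pow y (2 ℕ.* suc k))
      ≡⟨ cong₂ (λ a b → σ * a * c * inv b) qᴱ⁺⁽ᵏ⁺¹⁾ʳ y²⁽ᵏ⁺¹⁾ ⟩
    σ * (pow q (E ℕ.+ k ℕ.* r) * pow q r) * c * inv (pow y (2 ℕ.* k) * pow y 2)
      ≡⟨ cong (σ * (pow q (E ℕ.+ k ℕ.* r) * pow q r) * c *_) (inv-* (pow y (2 ℕ.* k)) (pow y 2)) ⟩
    σ * (pow q (E ℕ.+ k ℕ.* r) * pow q r) * c * (inv (pow y (2 ℕ.* k)) * inv (pow y 2))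
      ≡⟨ solve 6 (λ σ t a c i j → σ :* (t :* a) :* c :* (i :* j) := σ :* t :* c :* i :* (a :* j))
           refl σ (pow q (E ℕ.+ k ℕ.* r)) (pow q r) c (inv (pow y (2 ℕ.* k))) (inv (pow y 2)) ⟩
    coefficient k r * rhsFactor q r ∎
    where
    E : ℕ
    E = r ℕ.* (r ∸ 1) ℕ./ 2
    σ c y : ℚ
    σ = pow (- 1ℚ) (r ∸ 1)
    c = 1ℚ + pow q r
    y = 1ℚ - pow q r
    qᴱ⁺⁽ᵏ⁺¹⁾ʳ : pow q (E ℕ.+ (r ℕ.+ k ℕ.* r)) ≡ pow q (E ℕ.+ k ℕ.* r) * pow q r
    qᴱ⁺⁽ᵏ⁺¹⁾ʳ = trans (cong (pow q) (trans (cong (E ℕ.+_) (ℕ.+-comm r (k ℕ.* r))) (sym (ℕ.+-assoc E (k ℕ.* r) r))))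
                       (pow-+ q (E ℕ.+ k ℕ.* r) r)
    y²⁽ᵏ⁺¹⁾ : pow y (2 ℕ.* suc k) ≡ pow y (2 ℕ.* k) * pow y 2
    y²⁽ᵏ⁺¹⁾ = trans (cong (pow y) (trans (ℕ.*-suc 2 k) (ℕ.+-comm 2 (2 ℕ.* k)))) (pow-+ y (2 ℕ.* k) 2)

  coefficient-zero : ∀ r → coefficient 0 (suc r) ≡ pow (- 1ℚ) r * pow q (tri (suc r)) * (1ℚ + pow q (suc r))
  coefficient-zero r = begin
    pow (- 1ℚ) r * pow q (suc r ℕ.* r ℕ./ 2 ℕ.+ 0) * (1ℚ + pow q (suc r)) * 1ℚ
      ≡⟨ *-identityʳ _ ⟩
    pow (- 1ℚ) r * pow q (suc r ℕ.* r ℕ./ 2 ℕ.+ 0) * (1ℚ + pow q (suc r))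
      ≡⟨ cong (λ e → pow (- 1ℚ) r * pow q e * (1ℚ + pow q (suc r))) (trans (ℕ.+-identityʳ _) (n*[n∸1]/2≡tri (suc r))) ⟩
    pow (- 1ℚ) r * pow q (tri (suc r)) * (1ℚ + pow q (suc r)) ∎

qf-at-0 : ∀ n → qf 0ℚ n ≡ 1ℚ
qf-at-0 zero    = refl
qf-at-0 (suc n) = trans (cong (_* (1ℚ - 0ℚ * pow 0ℚ n)) (qf-at-0 n)) (cong (λ x → 1ℚ * (1ℚ - x)) (*-zeroˡ (pow 0ℚ n)))

weight-at-0 : ∀ N r → weight 0ℚ N r ≡ 1ℚ
weight-at-0 N r = begin
  pow (qf 0ℚ N) 2 * inv (qf 0ℚ (N ∸ r) * qf 0ℚ (N ℕ.+ r))
    ≡⟨ cong₂ (λ x y → pow x 2 * inv y) (qf-at-0 N) (cong₂ _*_ (qf-at-0 (N ∸ r)) (qf-at-0 (N ℕ.+ r))) ⟩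
  pow 1ℚ 2 * inv (1ℚ * 1ℚ)
    ≡⟨⟩
  1ℚ ∎

lhsSum-zero-at-0 : ∀ M → lhsSum 0ℚ (suc M) 0 ≡ 1ℚ
lhsSum-zero-at-0 M = begin
  lhsSum 0ℚ (suc M) 0
    ≡⟨ sum1-suc M (λ r → coefficient 0ℚ 0 r * weight 0ℚ (suc M) r) ⟩
  coefficient 0ℚ 0 1 * weight 0ℚ (suc M) 1 + sum1 M (λ r → coefficient 0ℚ 0 (suc r) * weight 0ℚ (suc M) (suc r))
    ≡⟨ cong₂ _+_ (cong (coefficient 0ℚ 0 1 *_) (weight-at-0 (suc M) 1)) (trans (sum1-cong M vanishing) (sum1-0 M)) ⟩
  1ℚ + 0ℚ
    ≡⟨⟩
  1ℚ ∎
  where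
  vanishing : ∀ r → 1 ≤ r → r ≤ M → coefficient 0ℚ 0 (suc r) * weight 0ℚ (suc M) (suc r) ≡ 0ℚ
  vanishing (suc r) _ _ = begin
    coefficient 0ℚ 0 (2 ℕ.+ r) * weight 0ℚ (suc M) (2 ℕ.+ r)
      ≡⟨ cong (_* weight 0ℚ (suc M) (2 ℕ.+ r)) (coefficient-zero 0ℚ (suc r)) ⟩
    pow (- 1ℚ) (suc r) * pow 0ℚ (tri (suc r) ℕ.+ suc r) * (1ℚ + pow 0ℚ (2 ℕ.+ r)) * weight 0ℚ (suc M) (2 ℕ.+ r)
      ≡⟨ cong (λ e → pow (- 1ℚ) (suc r) * pow 0ℚ e * (1ℚ + pow 0ℚ (2 ℕ.+ r)) * weight 0ℚ (suc M) (2 ℕ.+ r)) (ℕ.+-suc (tri (suc r)) r) ⟩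
    pow (- 1ℚ) (suc r) * (pow 0ℚ (tri (suc r) ℕ.+ r) * 0ℚ) * (1ℚ + pow 0ℚ (2 ℕ.+ r)) * weight 0ℚ (suc M) (2 ℕ.+ r)
      ≡⟨ solve 4 (λ s p c w → s :* (p :* con 0ℚ) :* c :* w := con 0ℚ)
           refl (pow (- 1ℚ) (suc r)) (pow 0ℚ (tri (suc r) ℕ.+ r)) (1ℚ + pow 0ℚ (2 ℕ.+ r)) (weight 0ℚ (suc M) (2 ℕ.+ r)) ⟩
    0ℚ ∎

module _ {q : ℚ} (q≢1 : q ≢ 1ℚ) (q≢-1 : q ≢ - 1ℚ) where

  ∣q∣≢1 : ∣ q ∣ ≢ 1ℚ
  ∣q∣≢1 ∣q∣≡1 with ∣p∣≡p∨∣p∣≡-p q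
  ... | inj₁ ∣q∣≡q  = q≢1 (trans (sym ∣q∣≡q) ∣q∣≡1)
  ... | inj₂ ∣q∣≡-q = q≢-1 (trans (sym (⁻¹-involutive q)) (cong -_ (trans (sym ∣q∣≡-q) ∣q∣≡1)))

  pow[1+n]≢1 : ∀ n → pow q (suc n) ≢ 1ℚ
  pow[1+n]≢1 n qⁿ⁺¹≡1 =
    ∣q∣≢1 (pow[1+n]≡1⇒≡1 ∣ q ∣ {{∣-∣-nonNeg q}} n (trans (sym (∣pow∣ q (suc n))) (cong ∣_∣ qⁿ⁺¹≡1)))

  1-pow[1+n]≢0 : ∀ n → 1ℚ - pow q (suc n) ≢ 0ℚ
  1-pow[1+n]≢0 n 1-qⁿ⁺¹≡0 = pow[1+n]≢1 n (sym (x∙y⁻¹≈ε⇒x≈y 1ℚ (pow q (suc n)) 1-qⁿ⁺¹≡0))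

  qf≢0 : ∀ n → qf q n ≢ 0ℚ
  qf≢0 zero    ()
  qf≢0 (suc n) = subst (_≢ 0ℚ) (sym (qf-suc q n)) (*-≢0 (qf≢0 n) (1-pow[1+n]≢0 n))

  weight-suc : ∀ {M r} → 1 ≤ r → r ≤ M →
    weight q (suc M) r * (rhsFactor q r - rhsFactor q (suc M)) ≡ weight q M r * rhsFactor q r
  weight-suc {M} {suc r′} _ r≤M = begin
    pow (qf q (suc M)) 2 * inv (qf q (suc M ∸ r) * qf q (suc (M ℕ.+ r))) * Δ
      ≡⟨ cong₂ (λ x y → pow x 2 * inv (y * qf q (suc (M ℕ.+ r))) * Δ) (qf-suc q M) (trans (cong (qf q) (ℕ.+-∸-assoc 1 r≤M)) (qf-suc q (M ∸ r))) ⟩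
    pow (qf q M * (1ℚ - b)) 2 * inv (qf q (M ∸ r) * (1ℚ - c) * qf q (suc (M ℕ.+ r))) * Δ
      ≡⟨ cong (λ x → pow (qf q M * (1ℚ - b)) 2 * inv (qf q (M ∸ r) * (1ℚ - c) * x) * Δ) qf[1+M+r] ⟩
    pow (qf q M * (1ℚ - b)) 2 * inv (qf q (M ∸ r) * (1ℚ - c) * (qf q (M ℕ.+ r) * (1ℚ - a * b))) * Δ
      ≡⟨ cong₂ (λ x y → x * inv y * Δ) (pow-distrib-* (qf q M) (1ℚ - b) 2)
           (solve 4 (λ u c v d → u :* c :* (v :* d) := u :* v :* (c :* d)) refl (qf q (M ∸ r)) (1ℚ - c) (qf q (M ℕ.+ r)) (1ℚ - a * b)) ⟩
    pow (qf q M) 2 * pow (1ℚ - b) 2 * inv (Q * ((1ℚ - c) * (1ℚ - a * b))) * Δ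
      ≡⟨ cong (λ x → pow (qf q M) 2 * pow (1ℚ - b) 2 * x * Δ) (inv-* Q ((1ℚ - c) * (1ℚ - a * b))) ⟩
    pow (qf q M) 2 * pow (1ℚ - b) 2 * (inv Q * inv ((1ℚ - c) * (1ℚ - a * b))) * Δ
      ≡⟨ solve 5 (λ P B i j Δ → P :* B :* (i :* j) :* Δ := P :* i :* (B :* j :* Δ))
           refl (pow (qf q M) 2) (pow (1ℚ - b) 2) (inv Q) (inv ((1ℚ - c) * (1ℚ - a * b))) Δ ⟩
    weight q M r * (pow (1ℚ - b) 2 * inv ((1ℚ - c) * (1ℚ - a * b)) * Δ)
      ≡⟨ cong (weight q M r *_) (x/[1-x]²-step {a} {b} {c} ca≡b (1-pow[1+n]≢0 r′) (1-pow[1+n]≢0 M) (1-pow[1+n]≢0 (M ∸ r)) 1-ab≢0) ⟩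
    weight q M r * rhsFactor q r ∎
    where
    r : ℕ
    r = suc r′
    a b c Q Δ : ℚ
    a = pow q r
    b = pow q (suc M)
    c = pow q (suc (M ∸ r))
    Q = qf q (M ∸ r) * qf q (M ℕ.+ r)
    Δ = rhsFactor q r - rhsFactor q (suc M)
    ca≡b : c * a ≡ b
    ca≡b = trans (sym (pow-+ q (suc (M ∸ r)) r)) (cong (pow q ∘ suc) (ℕ.m∸n+n≡m r≤M))
    ab≡qᴹ⁺ʳ⁺¹ : a * b ≡ pow q (suc (M ℕ.+ r))
    ab≡qᴹ⁺ʳ⁺¹ = trans (sym (pow-+ q r (suc M))) (cong (pow q) (trans (ℕ.+-suc r M) (cong suc (ℕ.+-comm r M))))
    qf[1+M+r] : qf q (suc (M ℕ.+ r)) ≡ qf q (M ℕ.+ r) * (1ℚ - a * b)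
    qf[1+M+r] = trans (qf-suc q (M ℕ.+ r)) (cong (λ x → qf q (M ℕ.+ r) * (1ℚ - x)) (sym ab≡qᴹ⁺ʳ⁺¹))
    1-ab≢0 : 1ℚ - a * b ≢ 0ℚ
    1-ab≢0 = subst (λ x → 1ℚ - x ≢ 0ℚ) (sym ab≡qᴹ⁺ʳ⁺¹) (1-pow[1+n]≢0 (M ℕ.+ r))

  lhsSum-suc : ∀ M k → lhsSum q (suc M) (suc k) ≡ lhsSum q M (suc k) + rhsFactor q (suc M) * lhsSum q (suc M) k
  lhsSum-suc M k = begin
    sum1 M (λ r → coefficient q (suc k) r * W′ r) + coefficient q (suc k) (suc M) * W′ (suc M)
      ≡⟨ cong₂ _+_ (sum1-cong M λ r 1≤r r≤M → split 1≤r r≤M) last ⟩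
    sum1 M (λ r → coefficient q (suc k) r * W r + F * (coefficient q k r * W′ r)) + F * (coefficient q k (suc M) * W′ (suc M))
      ≡⟨ cong (_+ F * (coefficient q k (suc M) * W′ (suc M)))
           (trans (sum1-distrib-+ M _ _) (cong (lhsSum q M (suc k) +_) (sym (*-distribˡ-sum1 M F _)))) ⟩
    lhsSum q M (suc k) + F * sum1 M (λ r → coefficient q k r * W′ r) + F * (coefficient q k (suc M) * W′ (suc M))
      ≡⟨ solve 4 (λ a F s l → a :+ F :* s :+ F :* l := a :+ F :* (s :+ l))
           refl (lhsSum q M (suc k)) F (sum1 M (λ r → coefficient q k r * W′ r)) (coefficient q k (suc M) * W′ (suc M)) ⟩
    lhsSum q M (suc k) + F * lhsSum q (suc M) k ∎
    where
    F : ℚ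
    F = rhsFactor q (suc M)
    W W′ : ℕ → ℚ
    W  = weight q M
    W′ = weight q (suc M)
    split : ∀ {r} → 1 ≤ r → r ≤ M → coefficient q (suc k) r * W′ r ≡ coefficient q (suc k) r * W r + F * (coefficient q k r * W′ r)
    split {r} 1≤r r≤M = begin
      coefficient q (suc k) r * W′ r
        ≡⟨ cong (_* W′ r) (coefficient-suc q k r) ⟩
      γ * f * W′ r
        ≡⟨ solve 4 (λ γ f W′ F → γ :* f :* W′ := γ :* (W′ :* (f :- F)) :+ F :* (γ :* W′)) refl γ f (W′ r) F ⟩
      γ * (W′ r * (f - F)) + F * (γ * W′ r)
        ≡⟨ cong (λ x → γ * x + F * (γ * W′ r)) (weight-suc 1≤r r≤M) ⟩
      γ * (W r * f) + F * (γ * W′ r)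
        ≡⟨ cong (_+ F * (γ * W′ r)) (solve 3 (λ γ W f → γ :* (W :* f) := γ :* f :* W) refl γ (W r) f) ⟩
      γ * f * W r + F * (γ * W′ r)
        ≡⟨ cong (λ x → x * W r + F * (γ * W′ r)) (sym (coefficient-suc q k r)) ⟩
      coefficient q (suc k) r * W r + F * (γ * W′ r) ∎
      where
      γ f : ℚ
      γ = coefficient q k r
      f = rhsFactor q r
    last : coefficient q (suc k) (suc M) * W′ (suc M) ≡ F * (coefficient q k (suc M) * W′ (suc M))
    last = trans (cong (_* W′ (suc M)) (coefficient-suc q k (suc M)))
                 (solve 3 (λ γ F W → γ :* F :* W := F :* (γ :* W)) refl (coefficient q k (suc M)) F (W′ (suc M)))

  module SymmetricRothe (q≢0 : q ≢ 0ℚ) (N : ℕ) where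

    g : ℕ → ℚ
    g = rotheTerm q (pow q N) (N ℕ.+ N)

    Q : ℕ → ℚ
    Q r = qf q (N ∸ r) * qf q (N ℕ.+ r)

    Z K : ℚ
    Z = qf q (N ℕ.+ N)
    K = pow (- 1ℚ) N * pow q (tri N ℕ.+ N ℕ.* N)

    Q≢0 : ∀ r → Q r ≢ 0ℚ
    Q≢0 r = *-≢0 (qf≢0 (N ∸ r)) (qf≢0 (N ℕ.+ r))

    qbinom-upper : ∀ {r} → r ≤ N → qbinom q (N ℕ.+ N) (N ℕ.+ r) ≡ Z * inv (Q r)
    qbinom-upper {r} r≤N = x*y≡z⇒x≡z*inv[y] (begin
      b * (qf q (N ∸ r) * qf q (N ℕ.+ r))
        ≡⟨ solve 3 (λ b x y → b :* (x :* y) := b :* y :* x) refl b (qf q (N ∸ r)) (qf q (N ℕ.+ r)) ⟩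
      b * qf q (N ℕ.+ r) * qf q (N ∸ r)
        ≡⟨ cong (λ m → b * qf q (N ℕ.+ r) * qf q m) (sym (ℕ.[m+n]∸[m+o]≡n∸o N N r)) ⟩
      b * qf q (N ℕ.+ r) * qf q (N ℕ.+ N ∸ (N ℕ.+ r))
        ≡⟨ qbinom*qf*qf q (ℕ.+-monoʳ-≤ N r≤N) ⟩
      Z ∎) (Q≢0 r)
      where
      b : ℚ
      b = qbinom q (N ℕ.+ N) (N ℕ.+ r)

    qbinom-lower : ∀ {r} → r ≤ N → qbinom q (N ℕ.+ N) (N ∸ r) ≡ Z * inv (Q r)
    qbinom-lower {r} r≤N = x*y≡z⇒x≡z*inv[y] (begin
      b * (qf q (N ∸ r) * qf q (N ℕ.+ r))               ≡⟨ sym (*-assoc b (qf q (N ∸ r)) (qf q (N ℕ.+ r))) ⟩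
      b * qf q (N ∸ r) * qf q (N ℕ.+ r)                 ≡⟨ cong (λ m → b * qf q (N ∸ r) * qf q m) (sym (m+m∸[m∸r]≡m+r r≤N)) ⟩
      b * qf q (N ∸ r) * qf q (N ℕ.+ N ∸ (N ∸ r))       ≡⟨ qbinom*qf*qf q (ℕ.≤-trans (ℕ.m∸n≤m N r) (ℕ.m≤m+n N N)) ⟩
      Z                                                 ∎) (Q≢0 r)
      where
      b : ℚ
      b = qbinom q (N ℕ.+ N) (N ∸ r)

    rotheTerm-upper : ∀ {r} → r ≤ N → g (N ℕ.+ r) ≡ K * (pow (- 1ℚ) r * pow q (tri r)) * (Z * inv (Q r))
    rotheTerm-upper {r} r≤N = begin
      pow (- 1ℚ) (N ℕ.+ r) * pow q (tri (N ℕ.+ r)) * pow (pow q N) (N ℕ.+ N ∸ (N ℕ.+ r)) * qbinom q (N ℕ.+ N) (N ℕ.+ r)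
        ≡⟨ cong₂ (λ x y → x * pow q (tri (N ℕ.+ r)) * y * qbinom q (N ℕ.+ N) (N ℕ.+ r)) (pow-+ (- 1ℚ) N r)
             (trans (cong (pow (pow q N)) (ℕ.[m+n]∸[m+o]≡n∸o N N r)) (pow-pow q N (N ∸ r))) ⟩
      pow (- 1ℚ) N * pow (- 1ℚ) r * pow q (tri (N ℕ.+ r)) * pow q (N ℕ.* (N ∸ r)) * qbinom q (N ℕ.+ N) (N ℕ.+ r)
        ≡⟨ cong (pow (- 1ℚ) N * pow (- 1ℚ) r * pow q (tri (N ℕ.+ r)) * pow q (N ℕ.* (N ∸ r)) *_) (qbinom-upper r≤N) ⟩
      pow (- 1ℚ) N * pow (- 1ℚ) r * pow q (tri (N ℕ.+ r)) * pow q (N ℕ.* (N ∸ r)) * (Z * inv (Q r))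
        ≡⟨ cong (_* (Z * inv (Q r))) (*-assoc (pow (- 1ℚ) N * pow (- 1ℚ) r) (pow q (tri (N ℕ.+ r))) (pow q (N ℕ.* (N ∸ r)))) ⟩
      pow (- 1ℚ) N * pow (- 1ℚ) r * (pow q (tri (N ℕ.+ r)) * pow q (N ℕ.* (N ∸ r))) * (Z * inv (Q r))
        ≡⟨ cong (λ x → pow (- 1ℚ) N * pow (- 1ℚ) r * x * (Z * inv (Q r))) exponent ⟩
      pow (- 1ℚ) N * pow (- 1ℚ) r * (pow q (tri N ℕ.+ N ℕ.* N) * pow q (tri r)) * (Z * inv (Q r))
        ≡⟨ solve 5 (λ σN σr P t X → σN :* σr :* (P :* t) :* X := σN :* P :* (σr :* t) :* X)
             refl (pow (- 1ℚ) N) (pow (- 1ℚ) r) (pow q (tri N ℕ.+ N ℕ.* N)) (pow q (tri r)) (Z * inv (Q r)) ⟩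
      K * (pow (- 1ℚ) r * pow q (tri r)) * (Z * inv (Q r)) ∎
      where
      exponent : pow q (tri (N ℕ.+ r)) * pow q (N ℕ.* (N ∸ r)) ≡ pow q (tri N ℕ.+ N ℕ.* N) * pow q (tri r)
      exponent = trans (sym (pow-+ q (tri (N ℕ.+ r)) (N ℕ.* (N ∸ r))))
                       (trans (cong (pow q) (tri[m+r]+m*[m∸r]≡tri[m]+m*m+tri[r] r≤N)) (pow-+ q (tri N ℕ.+ N ℕ.* N) (tri r)))

    rotheTerm-lower : ∀ {r} → r ≤ N → g (N ∸ r) ≡ K * (pow (- 1ℚ) r * pow q (tri r) * pow q r) * (Z * inv (Q r))
    rotheTerm-lower {r} r≤N = begin
      pow (- 1ℚ) (N ∸ r) * pow q (tri (N ∸ r)) * pow (pow q N) (N ℕ.+ N ∸ (N ∸ r)) * qbinom q (N ℕ.+ N) (N ∸ r)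
        ≡⟨ cong₂ (λ x y → x * pow q (tri (N ∸ r)) * y * qbinom q (N ℕ.+ N) (N ∸ r)) (pow[-1]-∸ r≤N)
             (trans (cong (pow (pow q N)) (m+m∸[m∸r]≡m+r r≤N)) (pow-pow q N (N ℕ.+ r))) ⟩
      pow (- 1ℚ) N * pow (- 1ℚ) r * pow q (tri (N ∸ r)) * pow q (N ℕ.* (N ℕ.+ r)) * qbinom q (N ℕ.+ N) (N ∸ r)
        ≡⟨ cong (pow (- 1ℚ) N * pow (- 1ℚ) r * pow q (tri (N ∸ r)) * pow q (N ℕ.* (N ℕ.+ r)) *_) (qbinom-lower r≤N) ⟩
      pow (- 1ℚ) N * pow (- 1ℚ) r * pow q (tri (N ∸ r)) * pow q (N ℕ.* (N ℕ.+ r)) * (Z * inv (Q r))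
        ≡⟨ cong (_* (Z * inv (Q r))) (*-assoc (pow (- 1ℚ) N * pow (- 1ℚ) r) (pow q (tri (N ∸ r))) (pow q (N ℕ.* (N ℕ.+ r)))) ⟩
      pow (- 1ℚ) N * pow (- 1ℚ) r * (pow q (tri (N ∸ r)) * pow q (N ℕ.* (N ℕ.+ r))) * (Z * inv (Q r))
        ≡⟨ cong (λ x → pow (- 1ℚ) N * pow (- 1ℚ) r * x * (Z * inv (Q r))) exponent ⟩
      pow (- 1ℚ) N * pow (- 1ℚ) r * (pow q (tri N ℕ.+ N ℕ.* N) * pow q (tri r) * pow q r) * (Z * inv (Q r))
        ≡⟨ solve 6 (λ σN σr P t a X → σN :* σr :* (P :* t :* a) :* X := σN :* P :* (σr :* t :* a) :* X)
             refl (pow (- 1ℚ) N) (pow (- 1ℚ) r) (pow q (tri N ℕ.+ N ℕ.* N)) (pow q (tri r)) (pow q r) (Z * inv (Q r)) ⟩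
      K * (pow (- 1ℚ) r * pow q (tri r) * pow q r) * (Z * inv (Q r)) ∎
      where
      exponent : pow q (tri (N ∸ r)) * pow q (N ℕ.* (N ℕ.+ r)) ≡ pow q (tri N ℕ.+ N ℕ.* N) * pow q (tri r) * pow q r
      exponent = begin
        pow q (tri (N ∸ r)) * pow q (N ℕ.* (N ℕ.+ r))     ≡⟨ sym (pow-+ q (tri (N ∸ r)) (N ℕ.* (N ℕ.+ r))) ⟩
        pow q (tri (N ∸ r) ℕ.+ N ℕ.* (N ℕ.+ r))           ≡⟨ cong (pow q) (tri[m∸r]+m*[m+r]≡tri[m]+m*m+tri[r]+r r≤N) ⟩
        pow q (tri N ℕ.+ N ℕ.* N ℕ.+ tri r ℕ.+ r)         ≡⟨ pow-+ q (tri N ℕ.+ N ℕ.* N ℕ.+ tri r) r ⟩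
        pow q (tri N ℕ.+ N ℕ.* N ℕ.+ tri r) * pow q r     ≡⟨ cong (_* pow q r) (pow-+ q (tri N ℕ.+ N ℕ.* N) (tri r)) ⟩
        pow q (tri N ℕ.+ N ℕ.* N) * pow q (tri r) * pow q r ∎

    rotheTerm-pair : ∀ {r} → 1 ≤ r → r ≤ N → g (N ∸ r) + g (N ℕ.+ r) ≡ (- (K * Z)) * (coefficient q 0 r * inv (Q r))
    rotheTerm-pair {suc r} _ r≤N = begin
      g (N ∸ suc r) + g (N ℕ.+ suc r)
        ≡⟨ cong₂ _+_ (rotheTerm-lower r≤N) (rotheTerm-upper r≤N) ⟩
      K * (σ * (- 1ℚ) * t * a) * (Z * i) + K * (σ * (- 1ℚ) * t) * (Z * i)
        ≡⟨ solve 6 (λ K σ t a Z i → K :* (σ :* (:- con 1ℚ) :* t :* a) :* (Z :* i) :+ K :* (σ :* (:- con 1ℚ) :* t) :* (Z :* i)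
                     := (:- (K :* Z)) :* (σ :* t :* (con 1ℚ :+ a) :* i)) refl K σ t a Z i ⟩
      (- (K * Z)) * (σ * t * (1ℚ + a) * i)
        ≡⟨ cong (λ c → (- (K * Z)) * (c * i)) (sym (coefficient-zero q r)) ⟩
      (- (K * Z)) * (coefficient q 0 (suc r) * i) ∎
      where
      σ t a i : ℚ
      σ = pow (- 1ℚ) r
      t = pow q (tri (suc r))
      a = pow q (suc r)
      i = inv (Q (suc r))

    centre : g N ≡ K * Z * inv (Q 0)
    centre = begin
      g N
        ≡⟨ cong g (sym (ℕ.+-identityʳ N)) ⟩
      g (N ℕ.+ 0)
        ≡⟨ rotheTerm-upper z≤n ⟩
      K * (1ℚ * 1ℚ) * (Z * inv (Q 0))
        ≡⟨ solve 3 (λ K Z i → K :* (con 1ℚ :* con 1ℚ) :* (Z :* i) := K :* Z :* i) refl K Z (inv (Q 0)) ⟩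
      K * Z * inv (Q 0) ∎

    Σcoefficient*invQ : 1 ≤ N → sum1 N (λ r → coefficient q 0 r * inv (Q r)) ≡ inv (Q 0)
    Σcoefficient*invQ 1≤N = sym (x∙y⁻¹≈ε⇒x≈y (inv (Q 0)) Σ (*-cancelˡ-≡0 KZ≢0 (begin
      K * Z * (inv (Q 0) - Σ)
        ≡⟨ solve 3 (λ KZ i S → KZ :* (i :- S) := KZ :* i :+ (:- KZ) :* S) refl (K * Z) (inv (Q 0)) Σ ⟩
      K * Z * inv (Q 0) + (- (K * Z)) * Σ
        ≡⟨ cong₂ _+_ (sym centre) (trans (*-distribˡ-sum1 N (- (K * Z)) _) (sym (sum1-cong N λ _ 1≤r r≤N → rotheTerm-pair 1≤r r≤N))) ⟩
      g N + sum1 N (λ r → g (N ∸ r) + g (N ℕ.+ r))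
        ≡⟨ sym (sum0-symmetric N g) ⟩
      sum0 (N ℕ.+ N) g
        ≡⟨ rothe q (pow q N) (N ℕ.+ N) ⟩
      rotheProduct q (pow q N) (N ℕ.+ N)
        ≡⟨ rotheProduct-vanishes q (ℕ.m<m+n N 1≤N) ⟩
      0ℚ ∎)))
      where
      Σ : ℚ
      Σ = sum1 N (λ r → coefficient q 0 r * inv (Q r))
      KZ≢0 : K * Z ≢ 0ℚ
      KZ≢0 = *-≢0 (*-≢0 (pow≢0 N λ ()) (pow≢0 (tri N ℕ.+ N ℕ.* N) q≢0)) (qf≢0 (N ℕ.+ N))

  lhsSum-zero : ∀ M → lhsSum q (suc M) 0 ≡ 1ℚ
  lhsSum-zero M with q ≟ 0ℚ
  ... | yes q≡0 = subst (λ x → lhsSum x (suc M) 0 ≡ 1ℚ) (sym q≡0) (lhsSum-zero-at-0 M)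
  ... | no  q≢0 = begin
    sum1 N (λ r → coefficient q 0 r * (P * inv (Q r)))
      ≡⟨ sum1-cong N (λ r _ _ → solve 3 (λ c P i → c :* (P :* i) := P :* (c :* i)) refl (coefficient q 0 r) P (inv (Q r))) ⟩
    sum1 N (λ r → P * (coefficient q 0 r * inv (Q r)))
      ≡⟨ sym (*-distribˡ-sum1 N P _) ⟩
    P * sum1 N (λ r → coefficient q 0 r * inv (Q r))
      ≡⟨ cong (P *_) (Σcoefficient*invQ (s≤s z≤n)) ⟩
    P * inv (qf q N * qf q (N ℕ.+ 0))
      ≡⟨ cong (λ m → P * inv (qf q N * qf q m)) (ℕ.+-identityʳ N) ⟩
    1ℚ * qf q N * qf q N * inv (qf q N * qf q N)
      ≡⟨ cong (λ x → x * qf q N * inv (qf q N * qf q N)) (*-identityˡ (qf q N)) ⟩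
    qf q N * qf q N * inv (qf q N * qf q N)
      ≡⟨ *-inverseʳ-inv (*-≢0 (qf≢0 N) (qf≢0 N)) ⟩
    1ℚ ∎
    where
    N : ℕ
    N = suc M
    P : ℚ
    P = pow (qf q N) 2
    open SymmetricRothe q≢0 N using (Q; Σcoefficient*invQ)

  lhsSum≡chainSum : ∀ k M → lhsSum q (suc M) k ≡ chainSum q k (suc M)
  lhsSum≡chainSum zero    M = lhsSum-zero M
  lhsSum≡chainSum (suc k) M = trans (lhsSum-suc M k) (cong₂ (λ x y → x + rhsFactor q (suc M) * y) (lower M) (lhsSum≡chainSum k M))
    where
    lower : ∀ M → lhsSum q M (suc k) ≡ chainSum q (suc k) M
    lower zero    = refl
    lower (suc M) = lhsSum≡chainSum (suc k) M

corollary5p2 : (N k : ℕ) → 1 ≤ N → 1 ≤ k → (q : ℚ) → q ≢ 1ℚ → q ≢ - 1ℚ →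
    LHS q N k ≡ RHS q N k
corollary5p2 (suc M) k _ _ q q≢1 q≢-1 = trans (LHS≡lhsSum q (suc M) k) (lhsSum≡chainSum q≢1 q≢-1 k M)
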